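{- Let $f$ and $g$ be functions of one variable and let $c$ be a parameter. Then $$\bigl(f(x_1)g(x_1)\bigr)\partial^c_1=f(x_1)\cdot\bigl(g(x_1)\partial^c_1\bigr)+\bigl(f(x_1)\partial^c_1\bigr)\cdot g(x_2),$$ and more generally, for every $n\ge1$, $$\bigl(f(x_1)g(x_1)\bigr)\partial^c_1\cdots\partial^c_n=\sum_{k=0}^n\bigl(f(x_1)\partial^c_1\cdots\partial^c_k\bigr)\cdot\bigl(g(x_{k+1})\partial^c_{k+1}\cdots\partial^c_n\bigr),$$ where an empty product of operators is the identity.
   Context: For a parameter $c$, the $i$-th $c$-divided difference operator $\partial^c_i$ acts (written on the right) on functions of variables $x_1,x_2,\ldots$ by $$f(x_1,\ldots,x_i,x_{i+1},\ldots)\,\partial^c_i=\frac{f(x_1,\ldots,x_i,x_{i+1},\ldots)-f(x_1,\ldots,x_{i+1},x_i,\ldots)}{(x_i-x_{i+1})(1-c/(x_ix_{i+1}))}.$$ A product $h\,\partial^c_1\cdots\partial^c_k$ means: apply $\partial^c_1$ first, then $\partial^c_2$, and so on. -}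

module Defs where

open import Level using (Level; _⊔_) renaming (suc to lsuc)
open import Data.Nat using (ℕ; zero; suc; _≡ᵇ_; _∸_)
open import Data.Bool using (if_then_else_)
open import Data.List using (List; foldr; map; upTo)
open import Relation.Nullary using (¬_)
open import Algebra.Bundles using (CommutativeRing)

-- A field, presented as a commutative ring with a *total* inverse
-- operation (convention 0⁻¹ = 0), nontrivial, and x * x⁻¹ ≈ 1 for x ≉ 0.
record Field (c ℓ : Level) : Set (lsuc (c ⊔ ℓ)) where
  field
    commutativeRing : CommutativeRing c ℓ
  open CommutativeRing commutativeRing public
  field
    _⁻¹       : Carrier → Carrier
    0≉1       : ¬ (0# ≈ 1#)
    ⁻¹-zero   : (0# ⁻¹) ≈ 0#
    ⁻¹-inverse : ∀ x → ¬ (x ≈ 0#) → (x * (x ⁻¹)) ≈ 1#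

module DividedDifference {c ℓ : Level} (F : Field c ℓ) where
  open Field F

  -- A point (x_1, x_2, ...): the variable x_i is  x i  for i ≥ 1
  -- (the component  x 0  is unused by everything below).
  Point : Set c
  Point = ℕ → Carrier

  Fun : Set c
  Fun = Point → Carrier

  swapAt : ℕ → Point → Point
  swapAt i x j =
    if j ≡ᵇ i then x (suc i) else (if j ≡ᵇ suc i then x i else x j)

  ∂ : Carrier → ℕ → Fun → Fun
  ∂ cc i h x =
    (h x - h (swapAt i x)) *
    (((x i - x (suc i)) * (1# - cc * ((x i * x (suc i)) ⁻¹))) ⁻¹)

  -- ∂s cc i m h  =  h ∂^c_i ∂^c_{i+1} ⋯ ∂^c_{i+m-1}
  -- (operators applied left to right; m = 0 gives the identity)
  ∂s : Carrier → ℕ → ℕ → Fun → Fun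
  ∂s cc i zero    h = h
  ∂s cc i (suc m) h = ∂s cc (suc i) m (∂ cc i h)

  Σ≤ : ℕ → (ℕ → Carrier) → Carrier
  Σ≤ n t = foldr _+_ 0# (map t (upTo (suc n)))

-- Since h∂ᶜᵢ is (h − sᵢh) times a factor independent of h, it obeys the
-- twisted Leibniz rule
--   (A B)∂ᵢ = A · (B∂ᵢ) + (A∂ᵢ) · (sᵢ B),
-- and A∂ᵢ = 0 whenever A is sᵢ-invariant. Now f(x₁)∂₁⋯∂ₖ only involves
-- x₁,…,xₖ₊₁, so it is invariant under sₙ₊₁ for k < n. Applying ∂ₙ₊₁ to the
-- n-th formula therefore only touches the derivatives of the g-factors,
-- except in the last summand, where sₙ₊₁ g(xₙ₊₁) = g(xₙ₊₂) produces the
-- new (n+1)-st term.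
module Submission where

open import Defs
open import Data.Nat.Base as ℕ using (ℕ; zero; suc; _∸_; _≤_; _<_; _≡ᵇ_; z≤n; s≤s)
open import Data.Nat.Properties using (≤-refl; ≤-trans; n≤1+n; <⇒≤; +-∸-assoc; m+[n∸m]≡n; n∸n≡0)
import Data.Nat.Properties as ℕₚ
open import Data.Bool.Base using (true; false)
open import Data.List.Base using (List; []; _∷_; foldr; map; applyUpTo; upTo)
open import Function.Base using (id)
open import Data.Product.Base using (_×_; _,_)
open import Relation.Binary.PropositionalEquality as ≡ using (_≡_)
open import Algebra.Bundles using (Ring)
import Algebra.Properties.Ring as RingProperties
import Algebra.Properties.AbelianGroup as AbelianGroupProperties
import Algebra.Properties.CommutativeSemigroup as CommutativeSemigroupProperties
import Relation.Binary.Reasoning.Setoid as SetoidReasoning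

m<n⇒m≡ᵇn≡false : ∀ {m n} → m < n → (m ≡ᵇ n) ≡ false
m<n⇒m≡ᵇn≡false {zero}  {suc n} _         = ≡.refl
m<n⇒m≡ᵇn≡false {suc m} {suc n} (s≤s m<n) = m<n⇒m≡ᵇn≡false m<n

n≡ᵇn≡true : ∀ n → (n ≡ᵇ n) ≡ true
n≡ᵇn≡true zero    = ≡.refl
n≡ᵇn≡true (suc n) = n≡ᵇn≡true n

module DifferenceIdentities {c ℓ} (R : Ring c ℓ) where
  open Ring R
  open RingProperties R using (x[y-z]≈xy-xz; [y-z]x≈yx-zx)
  open AbelianGroupProperties +-abelianGroup using (⁻¹-∙-comm)
  open CommutativeSemigroupProperties +-commutativeSemigroup using (interchange)
  open SetoidReasoning setoid

  [x+y]-[u+v]≈[x-u]+[y-v] : ∀ x y u v → (x + y) - (u + v) ≈ (x - u) + (y - v)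
  [x+y]-[u+v]≈[x-u]+[y-v] x y u v =
    trans (+-congˡ (sym (⁻¹-∙-comm u v))) (interchange x y (- u) (- v))

  xy-uv≈x[y-v]+[x-u]v : ∀ x y u v → x * y - u * v ≈ x * (y - v) + (x - u) * v
  xy-uv≈x[y-v]+[x-u]v x y u v = sym (begin
    x * (y - v) + (x - u) * v             ≈⟨ +-cong (x[y-z]≈xy-xz x y v) ([y-z]x≈yx-zx v x u) ⟩
    (x * y - x * v) + (x * v - u * v)     ≈⟨ +-assoc (x * y) (- (x * v)) _ ⟩
    x * y + (- (x * v) + (x * v - u * v)) ≈⟨ +-congˡ (sym (+-assoc (- (x * v)) (x * v) _)) ⟩
    x * y + ((- (x * v) + x * v) - u * v) ≈⟨ +-congˡ (+-congʳ (-‿inverseˡ (x * v))) ⟩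
    x * y + (0# - u * v)                  ≈⟨ +-congˡ (+-identityˡ (- (u * v))) ⟩
    x * y - u * v                         ∎)

module _ {a ℓ} (F : Field a ℓ) where
  open Field F hiding (zero)
  open DividedDifference F
  open DifferenceIdentities ring
  open SetoidReasoning setoid

  swapAt-below : ∀ i x {j} → j < i → swapAt i x j ≡ x j
  swapAt-below i x {j} j<i
    rewrite m<n⇒m≡ᵇn≡false j<i | m<n⇒m≡ᵇn≡false (≤-trans j<i (n≤1+n i)) = ≡.refl

  swapAt-self : ∀ i x → swapAt i x i ≡ x (suc i)
  swapAt-self i x rewrite n≡ᵇn≡true i = ≡.refl

  swapAt-cong : ∀ i j {x y : Point} → x j ≡ y j → x i ≡ y i → x (suc i) ≡ y (suc i) →
                swapAt i x j ≡ swapAt i y j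
  swapAt-cong i j xj≡yj xi≡yi xi+1≡yi+1 with j ≡ᵇ i | j ≡ᵇ suc i
  ... | true  | _     = xi+1≡yi+1
  ... | false | true  = xi≡yi
  ... | false | false = xj≡yj

  ∂-cong : ∀ cc i {h h′ : Fun} → (∀ y → h y ≈ h′ y) → ∀ x → ∂ cc i h x ≈ ∂ cc i h′ x
  ∂-cong cc i h≈h′ x = *-congʳ (+-cong (h≈h′ x) (-‿cong (h≈h′ (swapAt i x))))

  ∂-invariant : ∀ cc i (h : Fun) x → h (swapAt i x) ≈ h x → ∂ cc i h x ≈ 0#
  ∂-invariant cc i h x hs≈h = begin
    (h x - h (swapAt i x)) * _ ≈⟨ *-congʳ (+-congˡ (-‿cong hs≈h)) ⟩
    (h x - h x) * _           ≈⟨ *-congʳ (-‿inverseʳ (h x)) ⟩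
    0# * _                    ≈⟨ zeroˡ _ ⟩
    0#                        ∎

  ∂-+ : ∀ cc i (h h′ : Fun) x → ∂ cc i (λ y → h y + h′ y) x ≈ ∂ cc i h x + ∂ cc i h′ x
  ∂-+ cc i h h′ x = trans (*-congʳ ([x+y]-[u+v]≈[x-u]+[y-v] _ _ _ _)) (distribʳ _ _ _)

  ∂-foldr-+ : ∀ cc i {A : Set} (T : A → Fun) (ks : List A) x →
              ∂ cc i (λ y → foldr _+_ 0# (map (λ k → T k y) ks)) x
                ≈ foldr _+_ 0# (map (λ k → ∂ cc i (T k) x) ks)
  ∂-foldr-+ cc i T []       x = ∂-invariant cc i (λ _ → 0#) x refl
  ∂-foldr-+ cc i T (k ∷ ks) x =
    trans (∂-+ cc i (T k) (λ y → foldr _+_ 0# (map (λ k → T k y) ks)) x) (+-congˡ (∂-foldr-+ cc i T ks x))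

  ∂-*-leibniz : ∀ cc i (A B : Fun) x →
                ∂ cc i (λ y → A y * B y) x ≈ A x * ∂ cc i B x + ∂ cc i A x * B (swapAt i x)
  ∂-*-leibniz cc i A B x = begin
    (A x * B x - A x′ * B x′) * d                       ≈⟨ *-congʳ (xy-uv≈x[y-v]+[x-u]v _ _ _ _) ⟩
    (A x * (B x - B x′) + (A x - A x′) * B x′) * d       ≈⟨ distribʳ d _ _ ⟩
    A x * (B x - B x′) * d + (A x - A x′) * B x′ * d     ≈⟨ +-cong (*-assoc _ _ _) (*-assoc _ _ _) ⟩
    A x * ((B x - B x′) * d) + (A x - A x′) * (B x′ * d) ≈⟨ +-congˡ (*-congˡ (*-comm _ _)) ⟩
    A x * ((B x - B x′) * d) + (A x - A x′) * (d * B x′) ≈⟨ +-congˡ (sym (*-assoc _ _ _)) ⟩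
    A x * ((B x - B x′) * d) + (A x - A x′) * d * B x′   ∎
    where
    x′ : Point
    x′ = swapAt i x
    d : Carrier
    d = ((x i - x (suc i)) * (1# - cc * ((x i * x (suc i)) ⁻¹))) ⁻¹

  ∂-*-invariantˡ : ∀ cc i (A B : Fun) x → A (swapAt i x) ≈ A x →
                   ∂ cc i (λ y → A y * B y) x ≈ A x * ∂ cc i B x
  ∂-*-invariantˡ cc i A B x As≈A = begin
    ∂ cc i (λ y → A y * B y) x                             ≈⟨ ∂-*-leibniz cc i A B x ⟩
    A x * ∂ cc i B x + ∂ cc i A x * B (swapAt i x)        ≈⟨ +-congˡ (*-congʳ (∂-invariant cc i A x As≈A)) ⟩
    A x * ∂ cc i B x + 0# * B (swapAt i x)                ≈⟨ +-congˡ (zeroˡ _) ⟩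
    A x * ∂ cc i B x + 0#                                 ≈⟨ +-identityʳ _ ⟩
    A x * ∂ cc i B x                                      ∎

  foldr-+-applyUpTo-suc : ∀ (t : ℕ → Carrier) f n →
                          foldr _+_ 0# (map t (applyUpTo f (suc n)))
                            ≈ foldr _+_ 0# (map t (applyUpTo f n)) + t (f n)
  foldr-+-applyUpTo-suc t f zero    = trans (+-identityʳ _) (sym (+-identityˡ _))
  foldr-+-applyUpTo-suc t f (suc n) =
    trans (+-congˡ (foldr-+-applyUpTo-suc t (λ k → f (suc k)) n)) (sym (+-assoc _ _ _))

  Σ≤-suc : ∀ n t → Σ≤ (suc n) t ≈ Σ≤ n t + t (suc n)
  Σ≤-suc n t = foldr-+-applyUpTo-suc t id (suc n)

  Σ≤-cong : ∀ n {t u} → (∀ k → k ≤ n → t k ≈ u k) → Σ≤ n t ≈ Σ≤ n u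
  Σ≤-cong zero    t≈u = +-congʳ (t≈u 0 z≤n)
  Σ≤-cong (suc n) {t} {u} t≈u = begin
    Σ≤ (suc n) t        ≈⟨ Σ≤-suc n t ⟩
    Σ≤ n t + t (suc n)  ≈⟨ +-cong (Σ≤-cong n (λ k k≤n → t≈u k (≤-trans k≤n (n≤1+n n)))) (t≈u (suc n) ≤-refl) ⟩
    Σ≤ n u + u (suc n)  ≈⟨ Σ≤-suc n u ⟨
    Σ≤ (suc n) u        ∎

  Σ≤-splitLast : ∀ n {t u} → (∀ k → k < n → t k ≈ u k) → t n ≈ u n + u (suc n) →
                 Σ≤ n t ≈ Σ≤ (suc n) u
  Σ≤-splitLast zero {t} {u} _ t0≈u0+u1 = begin
    t 0 + 0#           ≈⟨ +-identityʳ (t 0) ⟩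
    t 0                ≈⟨ t0≈u0+u1 ⟩
    u 0 + u 1          ≈⟨ +-congʳ (+-identityʳ (u 0)) ⟨
    (u 0 + 0#) + u 1   ≈⟨ Σ≤-suc 0 u ⟨
    Σ≤ 1 u             ∎
  Σ≤-splitLast (suc n) {t} {u} t≈u tn≈un+un+1 = begin
    Σ≤ (suc n) t                       ≈⟨ Σ≤-suc n t ⟩
    Σ≤ n t + t (suc n)                 ≈⟨ +-cong (Σ≤-cong n (λ k k≤n → t≈u k (s≤s k≤n))) tn≈un+un+1 ⟩
    Σ≤ n u + (u (suc n) + u (suc (suc n))) ≈⟨ +-assoc _ _ _ ⟨
    Σ≤ n u + u (suc n) + u (suc (suc n))   ≈⟨ +-congʳ (Σ≤-suc n u) ⟨
    Σ≤ (suc n) u + u (suc (suc n))     ≈⟨ Σ≤-suc (suc n) u ⟨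
    Σ≤ (suc (suc n)) u                 ∎

  ∂s-suc : ∀ cc i m h → ∂s cc i (suc m) h ≡ ∂ cc (i ℕ.+ m) (∂s cc i m h)
  ∂s-suc cc i zero    h = ≡.cong (λ j → ∂ cc j h) (≡.sym (ℕₚ.+-identityʳ i))
  ∂s-suc cc i (suc m) h =
    ≡.trans (∂s-suc cc (suc i) m (∂ cc i h)) (≡.cong (λ j → ∂ cc j (∂s cc i (suc m) h)) (≡.sym (ℕₚ.+-suc i m)))

  ∂s-upTo-suc : ∀ cc {i j} h → i ≤ j → ∂s cc i (suc j ∸ i) h ≡ ∂ cc j (∂s cc i (j ∸ i) h)
  ∂s-upTo-suc cc {i} {j} h i≤j rewrite +-∸-assoc 1 i≤j =
    ≡.trans (∂s-suc cc i (j ∸ i) h) (≡.cong (λ l → ∂ cc l (∂s cc i (j ∸ i) h)) (m+[n∸m]≡n i≤j))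

  DependsOnlyOn : ℕ → Fun → Set _
  DependsOnlyOn m h = ∀ x y → (∀ j → j ≤ m → x j ≡ y j) → h x ≈ h y

  ∂-dependsOnlyOn : ∀ cc {i m h} → i ≤ m → DependsOnlyOn m h → DependsOnlyOn (suc m) (∂ cc i h)
  ∂-dependsOnlyOn cc {i} {m} i≤m dep x y agree =
    *-cong (+-cong (dep x y below) (-‿cong (dep _ _ (λ j j≤m → swapAt-cong i j (below j j≤m) xi≡yi xi+1≡yi+1))))
           (reflexive (≡.cong₂ (λ u v → ((u - v) * (1# - cc * ((u * v) ⁻¹))) ⁻¹) xi≡yi xi+1≡yi+1))
    where
    below : ∀ j → j ≤ m → x j ≡ y j
    below j j≤m = agree j (≤-trans j≤m (n≤1+n m))
    xi≡yi : x i ≡ y i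
    xi≡yi = below i i≤m
    xi+1≡yi+1 : x (suc i) ≡ y (suc i)
    xi+1≡yi+1 = agree (suc i) (s≤s i≤m)

  ∂s-dependsOnlyOn : ∀ cc k {i m h} → i ≤ m → DependsOnlyOn m h → DependsOnlyOn (m ℕ.+ k) (∂s cc i k h)
  ∂s-dependsOnlyOn cc zero {m = m} {h} _ dep =
    ≡.subst (λ M → DependsOnlyOn M h) (≡.sym (ℕₚ.+-identityʳ m)) dep
  ∂s-dependsOnlyOn cc (suc k) {i} {m} {h} i≤m dep =
    ≡.subst (λ M → DependsOnlyOn M (∂s cc i (suc k) h)) (≡.sym (ℕₚ.+-suc m k))
            (∂s-dependsOnlyOn cc k (s≤s i≤m) (∂-dependsOnlyOn cc i≤m dep))

  dependsOnlyOn⇒swapAt-invariant : ∀ {m h} i x → m < i → DependsOnlyOn m h → h (swapAt i x) ≈ h x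
  dependsOnlyOn⇒swapAt-invariant i x m<i dep =
    dep _ _ (λ j j≤m → swapAt-below i x (≤-trans (s≤s j≤m) m<i))

  module SumFormula (c : Carrier) (f g : Carrier → Carrier) where
    fg : Fun
    fg y = f (y 1) * g (y 1)

    fFactor : ℕ → Fun
    fFactor k = ∂s c 1 k (λ y → f (y 1))

    gFactor : ℕ → ℕ → Fun
    gFactor k n = ∂s c (suc k) (n ∸ k) (λ y → g (y (suc k)))

    fFactor-dependsOnlyOn : ∀ k → DependsOnlyOn (suc k) (fFactor k)
    fFactor-dependsOnlyOn k = ∂s-dependsOnlyOn c k ≤-refl (λ x y agree → reflexive (≡.cong f (agree 1 ≤-refl)))

    fFactor-suc : ∀ n x → fFactor (suc n) x ≡ ∂ c (suc n) (fFactor n) x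
    fFactor-suc n x = ≡.cong-app (∂s-suc c 1 n _) x

    gFactor-suc : ∀ {k n} → k ≤ n → ∀ x → gFactor k (suc n) x ≡ ∂ c (suc n) (gFactor k n) x
    gFactor-suc k≤n x = ≡.cong-app (∂s-upTo-suc c _ (s≤s k≤n)) x

    gFactor-diagonal : ∀ n y → gFactor n n y ≡ g (y (suc n))
    gFactor-diagonal n y = ≡.cong (λ m → ∂s c (suc n) m (λ y → g (y (suc n))) y) (n∸n≡0 n)

    term : ℕ → ℕ → Fun
    term k n y = fFactor k y * gFactor k n y

    ∂-term-below : ∀ {k n} → k < n → ∀ x → ∂ c (suc n) (term k n) x ≈ term k (suc n) x
    ∂-term-below {k} {n} k<n x = begin
      ∂ c (suc n) (term k n) x
        ≈⟨ ∂-*-invariantˡ c (suc n) (fFactor k) (gFactor k n) x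
             (dependsOnlyOn⇒swapAt-invariant (suc n) x (s≤s k<n) (fFactor-dependsOnlyOn k)) ⟩
      fFactor k x * ∂ c (suc n) (gFactor k n) x ≡⟨ ≡.cong (fFactor k x *_) (gFactor-suc (<⇒≤ k<n) x) ⟨
      term k (suc n) x                          ∎

    ∂-term-diagonal : ∀ n x → ∂ c (suc n) (term n n) x ≈ term n (suc n) x + term (suc n) (suc n) x
    ∂-term-diagonal n x = begin
      ∂ c (suc n) (term n n) x
        ≈⟨ ∂-*-leibniz c (suc n) (fFactor n) (gFactor n n) x ⟩
      fFactor n x * ∂ c (suc n) (gFactor n n) x + ∂ c (suc n) (fFactor n) x * gFactor n n (swapAt (suc n) x)
        ≡⟨ ≡.cong₂ (λ u v → fFactor n x * u + v) (≡.sym (gFactor-suc ≤-refl x))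
                   (≡.cong₂ _*_ (≡.sym (fFactor-suc n x)) shifted) ⟩
      term n (suc n) x + term (suc n) (suc n) x ∎
      where
      shifted : gFactor n n (swapAt (suc n) x) ≡ gFactor (suc n) (suc n) x
      shifted = ≡.trans (gFactor-diagonal n _)
                  (≡.trans (≡.cong g (swapAt-self (suc n) x)) (≡.sym (gFactor-diagonal (suc n) x)))

    sum-formula : ∀ n x → ∂s c 1 n fg x ≈ Σ≤ n (λ k → term k n x)
    sum-formula zero    x = sym (+-identityʳ _)
    sum-formula (suc n) x = begin
      ∂s c 1 (suc n) fg x                           ≡⟨ ≡.cong-app (∂s-suc c 1 n fg) x ⟩
      ∂ c (suc n) (∂s c 1 n fg) x                   ≈⟨ ∂-cong c (suc n) (sum-formula n) x ⟩
      ∂ c (suc n) (λ y → Σ≤ n (λ k → term k n y)) x ≈⟨ ∂-foldr-+ c (suc n) (λ k → term k n) (upTo (suc n)) x ⟩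
      Σ≤ n (λ k → ∂ c (suc n) (term k n) x)         ≈⟨ Σ≤-splitLast n (λ k k<n → ∂-term-below k<n x) (∂-term-diagonal n x) ⟩
      Σ≤ (suc n) (λ k → term k (suc n) x)           ∎

lemma2p1 : ∀ {a ℓ} (F : Field a ℓ) →
    let open Field F
        open DividedDifference F
    in (c : Carrier) (f g : Carrier → Carrier) →
       ( (x : Point) →
           ∂ c 1 (λ y → f (y 1) * g (y 1)) x
             ≈ (f (x 1) * ∂ c 1 (λ y → g (y 1)) x
                + ∂ c 1 (λ y → f (y 1)) x * g (x 2)) )
       × ( (n : ℕ) → 1 ≤ n → (x : Point) →
           ∂s c 1 n (λ y → f (y 1) * g (y 1)) x
             ≈ Σ≤ n (λ k → ∂s c 1 k (λ y → f (y 1)) x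
                          * ∂s c (suc k) (n ∸ k) (λ y → g (y (suc k))) x) )
-- The sum formula also holds for n = 0.
lemma2p1 F c f g = ∂-*-leibniz F c 1 (λ y → f (y 1)) (λ y → g (y 1)) , λ n _ → sum-formula n
  where open SumFormula F c f g
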